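{- Let $X$ be a non-empty finite set and let $N$ be a rooted binary phylogenetic $X$-network. Then there exists a unique decomposition $\mathcal{Z}=\{Z_1,\dots,Z_\ell\}$ of $N$ such that each $Z_i\in\mathcal{Z}$ is a maximal zig-zag trail in $N$.
   Context: All digraphs are finite, simple (no loops, no two arcs with the same tail and head) and acyclic. For an arc $a=(u,v)$ write ${\it tail}(a)=u$, ${\it head}(a)=v$; ${\it deg}^-_N(v)$ and ${\it deg}^+_N(v)$ denote in- and out-degree of $v$ in $N$. A leaf is a vertex with in-degree $1$ and out-degree $0$. A rooted binary phylogenetic $X$-network is a finite simple acyclic digraph $N$ such that (1) there is a unique vertex $\rho$ with ${\it deg}^-_N(\rho)=0$, and ${\it deg}^+_N(\rho)\in\{1,2\}$; (2) $X$ is the set of leaves of $N$; (3) every vertex $v\notin X\cup\{\rho\}$ satisfies $\{{\it deg}^-_N(v),{\it deg}^+_N(v)\}=\{1,2\}$. For a set $A'$ of arcs of a digraph $G$, $G[A']$ is the subgraph with arc set $A'$ and vertex set the heads and tails of arcs in $A'$. If $|A(G)|\ge 1$ and $\{A_1,\dots,A_\ell\}$ is a partition of $A(G)$ into non-empty disjoint sets, then $\{G[A_1],\dots,G[A_\ell]\}$ is called a decomposition of $G$. A zig-zag trail in $N$ is a connected subgraph $Z$ of $N$ with $|A(Z)|\ge1$ such that there is an ordering $(a_1,\dots,a_m)$ of $A(Z)$ with ${\it head}(a_i)={\it head}(a_{i+1})$ or ${\it tail}(a_i)={\it tail}(a_{i+1})$ for each $i\in[1,m-1]$. A zig-zag trail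 $Z$ is maximal if $N$ contains no zig-zag trail $Z'$ having $Z$ as a proper subgraph. -}

module Defs where

open import Data.Nat using (ℕ; zero; suc)
open import Data.Fin using (Fin)
open import Data.Fin.Subset using (Subset) renaming (_∈_ to _∈ₛ_)
open import Data.Bool using (Bool; T; if_then_else_)
open import Data.List using (List; map; allFin)
open import Data.Nat.ListAction using (sum)
open import Data.List.Membership.Propositional using () renaming (_∈_ to _∈ₗ_)
open import Data.List.Relation.Unary.Unique.Propositional using (Unique)
open import Data.List.Relation.Unary.Linked using (Linked)
open import Data.List.Relation.Unary.All using (All)
open import Data.List.Relation.Unary.Any using (Any)
open import Data.List.Relation.Unary.AllPairs using (AllPairs)
open import Data.Product using (Σ; ∃; _×_; _,_; proj₁; proj₂)
open import Data.Sum using (_⊎_)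
open import Relation.Binary.PropositionalEquality using (_≡_; _≢_)
open import Relation.Nullary using (¬_)
open import Function.Bundles using (_⇔_)

-- A finite digraph on vertex set Fin n, given by its arc relation:
-- E u v ≡ true iff (u , v) is an arc. (Bool-valued, so there is at most
-- one arc with a given tail and head, i.e. no parallel arcs.)
Digraph : ℕ → Set
Digraph n = Fin n → Fin n → Bool

ArcSet : ℕ → Set
ArcSet n = Fin n → Fin n → Bool

Arc : ℕ → Set
Arc n = Fin n × Fin n

tail head : ∀ {n} → Arc n → Fin n
tail = proj₁
head = proj₂

module _ {n : ℕ} where

  deg⁻ : Digraph n → Fin n → ℕ
  deg⁻ E v = sum (map (λ u → if E u v then 1 else 0) (allFin n))

  deg⁺ : Digraph n → Fin n → ℕ
  deg⁺ E u = sum (map (λ v → if E u v then 1 else 0) (allFin n))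

  data Path (E : Digraph n) : Fin n → Fin n → Set where
    arc  : ∀ {u v} → T (E u v) → Path E u v
    _∷ₚ_ : ∀ {u w v} → T (E u w) → Path E w v → Path E u v

  NoLoops : Digraph n → Set
  NoLoops E = ∀ v → ¬ T (E v v)

  Acyclic : Digraph n → Set
  Acyclic E = ∀ v → ¬ Path E v v

  IsLeaf : Digraph n → Fin n → Set
  IsLeaf E v = deg⁻ E v ≡ 1 × deg⁺ E v ≡ 0

  record IsRBPN (X : Subset n) (E : Digraph n) : Set where
    field
      noLoops  : NoLoops E
      acyclic  : Acyclic E
      root     : Fin n
      root-in  : deg⁻ E root ≡ 0
      root-out : deg⁺ E root ≡ 1 ⊎ deg⁺ E root ≡ 2
      root-unique : ∀ v → deg⁻ E v ≡ 0 → v ≡ root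
      leaves   : ∀ v → (v ∈ₛ X) ⇔ IsLeaf E v
      internal : ∀ v → ¬ (v ∈ₛ X) → v ≢ root →
                   (deg⁻ E v ≡ 1 × deg⁺ E v ≡ 2) ⊎ (deg⁻ E v ≡ 2 × deg⁺ E v ≡ 1)

  _∈A_ : Arc n → ArcSet n → Set
  a ∈A A = T (A (tail a) (head a))

  _⊆A_ : ArcSet n → ArcSet n → Set
  A ⊆A B = ∀ a → a ∈A A → a ∈A B

  _≐A_ : ArcSet n → ArcSet n → Set
  A ≐A B = ∀ u v → A u v ≡ B u v

  _⊊A_ : ArcSet n → ArcSet n → Set
  A ⊊A B = A ⊆A B × ¬ (A ≐A B)

  NonemptyA : ArcSet n → Set
  NonemptyA A = ∃ λ (a : Arc n) → a ∈A A

  InV : ArcSet n → Fin n → Set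
  InV A x = ∃ λ (a : Arc n) → a ∈A A × (tail a ≡ x ⊎ head a ≡ x)

  data UWalk (A : ArcSet n) : Fin n → Fin n → Set where
    stop : ∀ {x} → UWalk A x x
    fwd  : ∀ {x z y} → T (A x z) → UWalk A z y → UWalk A x y
    bwd  : ∀ {x z y} → T (A z x) → UWalk A z y → UWalk A x y

  Connected : ArcSet n → Set
  Connected A = ∀ x y → InV A x → InV A y → UWalk A x y

  ZZStep : Arc n → Arc n → Set
  ZZStep a b = head a ≡ head b ⊎ tail a ≡ tail b

  IsZigZag : Digraph n → ArcSet n → Set
  IsZigZag E A =
    A ⊆A E × NonemptyA A × Connected A ×
    (Σ (List (Arc n)) λ as →
        Unique as × (∀ a → (a ∈ₗ as) ⇔ (a ∈A A)) × Linked ZZStep as)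

  IsMaximalZigZag : Digraph n → ArcSet n → Set
  IsMaximalZigZag E A =
    IsZigZag E A × ¬ (Σ (ArcSet n) λ B → IsZigZag E B × A ⊊A B)

  IsDecomposition : Digraph n → List (ArcSet n) → Set
  IsDecomposition E D =
    All (λ A → A ⊆A E) D ×
    All NonemptyA D ×
    AllPairs (λ A B → ∀ a → ¬ (a ∈A A × a ∈A B)) D ×
    (∀ a → a ∈A E → Any (λ A → a ∈A A) D)

  SameFamily : List (ArcSet n) → List (ArcSet n) → Set
  SameFamily D D' =
    All (λ A → Any (λ B → A ≐A B) D') D × All (λ B → Any (λ A → B ≐A A) D) D'

module Submission where

-- In a binary network every vertex has in- and out-degree at most 2, so an arc shares its head
-- with at most one other arc and its tail with at most one other arc: in the graph on the arcs
-- whose edges join arcs sharing a head or a tail, every vertex has degree at most 2. Hence a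
-- zig-zag ordering can always be extended, at one of its ends, by any arc adjacent to it, and
-- growing such an ordering from an arc a until nothing is adjacent yields the connected
-- component of a as a zig-zag trail. It contains every zig-zag trail through a, so it is the
-- unique maximal zig-zag trail through a. These components partition the arcs, and every
-- decomposition into maximal zig-zag trails consists of them.

open import Defs
open import Data.Bool using (Bool; true; false; T; if_then_else_)
open import Data.Bool.Properties using (T?)
open import Data.Empty using (⊥; ⊥-elim)
open import Data.Fin using (Fin; zero; suc; _≟_)
open import Data.Fin.Properties using (injective⇒≤)
open import Data.Fin.Subset using (Subset; Nonempty)
open import Data.Fin.Subset.Properties renaming (_∈?_ to _∈ₛ?_) using ()
open import Data.List using (List; []; _∷_; _++_; [_]; length; lookup; map; filterᵇ; allFin; cartesianProduct)
open import Data.List.Properties using (length-++)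
open import Data.List.Membership.Propositional using (_∈_; _∉_; lose; find)
open import Data.List.Membership.Propositional.Properties
  using (∈-lookup; ∈-filter⁺; ∈-allFin; ∈-cartesianProduct⁺; ∈-++⁺ˡ)
open import Data.List.Relation.Binary.Subset.Propositional using (_⊆_)
open import Data.List.Relation.Unary.All as All using (All; []; _∷_)
open import Data.List.Relation.Unary.All.Properties using (¬Any⇒All¬; ∷ʳ⁺)
open import Data.List.Relation.Unary.Any as Any using (Any; here; there; any?; satisfied)
open import Data.List.Relation.Unary.Any.Properties using (lookup-index)
open import Data.List.Relation.Unary.AllPairs using (AllPairs; []; _∷_)
open import Data.List.Relation.Unary.Linked using (Linked; []; [-]; _∷_)
open import Data.List.Relation.Unary.Unique.Propositional using (Unique)
import Data.List.Relation.Unary.Unique.Propositional.Properties as Unique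
open import Data.Nat using (ℕ; zero; suc; _+_; _≤_; _<_; z≤n; s≤s)
open import Data.Nat.ListAction using (sum)
open import Data.Nat.Properties using (≤-trans; ≤-refl; +-suc; +-comm; +-identityʳ; <⇒≱)
open import Data.Product using (Σ; ∃; _×_; _,_; proj₁; proj₂)
open import Data.Product.Properties using (≡-dec)
open import Data.Sum using (_⊎_; inj₁; inj₂)
open import Function using (_∘_)
open import Function.Bundles using (_⇔_; mk⇔; Equivalence)
open import Function.Definitions using (Injective)
open import Relation.Binary.Definitions using (Symmetric; Decidable; DecidableEquality)
open import Relation.Binary.PropositionalEquality
  using (_≡_; _≢_; refl; sym; trans; cong; subst; ≢-sym; module ≡-Reasoning)
import Relation.Unary as U
open import Relation.Nullary using (¬_; yes; no; ¬?)
open import Relation.Nullary.Decidable using (⌊_⌋; _×-dec_; _⊎-dec_; toWitness; fromWitness; decidable-stable)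

module _ {A : Set} where

  lookup-injective : ∀ {xs : List A} → Unique xs → Injective _≡_ _≡_ (lookup xs)
  lookup-injective (_ ∷ _)    {zero}  {zero}  _ = refl
  lookup-injective (x∉xs ∷ _) {zero}  {suc j} e = ⊥-elim (All.lookup x∉xs (∈-lookup j) e)
  lookup-injective (x∉xs ∷ _) {suc i} {zero}  e = ⊥-elim (All.lookup x∉xs (∈-lookup i) (sym e))
  lookup-injective (_ ∷ xs!)  {suc i} {suc j} e = cong suc (lookup-injective xs! e)

  Unique⇒length≤ : ∀ {xs ys : List A} → Unique xs → xs ⊆ ys → length xs ≤ length ys
  Unique⇒length≤ {xs} {ys} xs! xs⊆ys = injective⇒≤ position-injective
    where
      position : Fin (length xs) → Fin (length ys)
      position i = Any.index (xs⊆ys (∈-lookup i))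

      position-injective : Injective _≡_ _≡_ position
      position-injective {i} {j} e = lookup-injective xs! (begin
        lookup xs i              ≡⟨ lookup-index (xs⊆ys (∈-lookup i)) ⟩
        lookup ys (position i)   ≡⟨ cong (lookup ys) e ⟩
        lookup ys (position j)   ≡⟨ sym (lookup-index (xs⊆ys (∈-lookup j))) ⟩
        lookup xs j              ∎)
        where open ≡-Reasoning

  sum-indicator≡length-filterᵇ : ∀ (p : A → Bool) xs →
    sum (map (λ x → if p x then 1 else 0) xs) ≡ length (filterᵇ p xs)
  sum-indicator≡length-filterᵇ p [] = refl
  sum-indicator≡length-filterᵇ p (x ∷ xs) with p x
  ... | true  = cong suc (sum-indicator≡length-filterᵇ p xs)
  ... | false = sum-indicator≡length-filterᵇ p xs

module _ {n} (E : Digraph n) where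

  length≤deg⁻ : ∀ {v} {us : List (Fin n)} → Unique us → All (λ u → T (E u v)) us →
    length us ≤ deg⁻ E v
  length≤deg⁻ {v} us! arcs
    rewrite sum-indicator≡length-filterᵇ (λ u → E u v) (allFin n) =
    Unique⇒length≤ us! (λ {u} u∈us → ∈-filter⁺ (T? ∘ λ u → E u v) (∈-allFin u) (All.lookup arcs u∈us))

  length≤deg⁺ : ∀ {u} {vs : List (Fin n)} → Unique vs → All (λ v → T (E u v)) vs →
    length vs ≤ deg⁺ E u
  length≤deg⁺ {u} vs! arcs
    rewrite sum-indicator≡length-filterᵇ (E u) (allFin n) =
    Unique⇒length≤ vs! (λ {v} v∈vs → ∈-filter⁺ (T? ∘ E u) (∈-allFin v) (All.lookup arcs v∈vs))

DegreesAtMostTwo : ∀ {n} → Digraph n → Set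
DegreesAtMostTwo E = ∀ v → deg⁻ E v ≤ 2 × deg⁺ E v ≤ 2

module _ {n} {X : Subset n} {E : Digraph n} (N : IsRBPN X E) where
  open IsRBPN N

  IsRBPN⇒DegreesAtMostTwo : DegreesAtMostTwo E
  IsRBPN⇒DegreesAtMostTwo v with v ∈ₛ? X | v ≟ root
  ... | yes v∈X | _ with Equivalence.to (leaves v) v∈X
  ...   | d⁻ , d⁺ rewrite d⁻ | d⁺ = s≤s z≤n , z≤n
  IsRBPN⇒DegreesAtMostTwo v | no _ | yes refl rewrite root-in with root-out
  ...   | inj₁ d⁺ rewrite d⁺ = z≤n , s≤s z≤n
  ...   | inj₂ d⁺ rewrite d⁺ = z≤n , ≤-refl
  IsRBPN⇒DegreesAtMostTwo v | no v∉X | no v≢root with internal v v∉X v≢root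
  ...   | inj₁ (d⁻ , d⁺) rewrite d⁻ | d⁺ = s≤s z≤n , ≤-refl
  ...   | inj₂ (d⁻ , d⁺) rewrite d⁻ | d⁺ = ≤-refl , s≤s z≤n

AtMostTwoNeighbours : {A : Set} → (A → Set) → (A → A → Set) → Set
AtMostTwoNeighbours P R = ∀ {y p q r} → All P (y ∷ p ∷ q ∷ r ∷ []) → Unique (y ∷ p ∷ q ∷ r ∷ []) →
  R p y → R q y → R r y → ⊥

module _ {n} {E : Digraph n} (deg≤2 : DegreesAtMostTwo E) where

  private
    3≰2 : ¬ 3 ≤ 2
    3≰2 (s≤s (s≤s ()))

  no-three-arcs-into : ∀ {a b c : Arc n} → All (_∈A E) (a ∷ b ∷ c ∷ []) →
    a ≢ b → a ≢ c → b ≢ c → head a ≡ head c → head b ≡ head c → ⊥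
  no-three-arcs-into {u₁ , v} {u₂ , _} {u₃ , _} (e₁ ∷ e₂ ∷ e₃ ∷ []) a≢b a≢c b≢c refl refl =
    3≰2 (≤-trans (length≤deg⁻ E tails! (e₁ ∷ e₂ ∷ e₃ ∷ [])) (proj₁ (deg≤2 v)))
    where
      tails! : Unique (u₁ ∷ u₂ ∷ u₃ ∷ [])
      tails! = (a≢b ∘ cong (_, v) ∷ a≢c ∘ cong (_, v) ∷ []) ∷ (b≢c ∘ cong (_, v) ∷ []) ∷ [] ∷ []

  no-three-arcs-out : ∀ {a b c : Arc n} → All (_∈A E) (a ∷ b ∷ c ∷ []) →
    a ≢ b → a ≢ c → b ≢ c → tail a ≡ tail c → tail b ≡ tail c → ⊥
  no-three-arcs-out {u , v₁} {_ , v₂} {_ , v₃} (e₁ ∷ e₂ ∷ e₃ ∷ []) a≢b a≢c b≢c refl refl =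
    3≰2 (≤-trans (length≤deg⁺ E heads! (e₁ ∷ e₂ ∷ e₃ ∷ [])) (proj₂ (deg≤2 u)))
    where
      heads! : Unique (v₁ ∷ v₂ ∷ v₃ ∷ [])
      heads! = (a≢b ∘ cong (u ,_) ∷ a≢c ∘ cong (u ,_) ∷ []) ∷ (b≢c ∘ cong (u ,_) ∷ []) ∷ [] ∷ []

  ZZStep-AtMostTwoNeighbours : AtMostTwoNeighbours (_∈A E) ZZStep
  ZZStep-AtMostTwoNeighbours (ey ∷ ep ∷ eq ∷ er ∷ [])
    ((y≢p ∷ y≢q ∷ y≢r ∷ []) ∷ (p≢q ∷ p≢r ∷ []) ∷ (q≢r ∷ []) ∷ [] ∷ []) = sides
    where
      sides : ZZStep _ _ → ZZStep _ _ → ZZStep _ _ → ⊥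
      sides (inj₁ p~y) (inj₁ q~y) _          = no-three-arcs-into (ep ∷ eq ∷ ey ∷ []) p≢q (≢-sym y≢p) (≢-sym y≢q) p~y q~y
      sides (inj₂ p~y) (inj₂ q~y) _          = no-three-arcs-out  (ep ∷ eq ∷ ey ∷ []) p≢q (≢-sym y≢p) (≢-sym y≢q) p~y q~y
      sides (inj₁ p~y) (inj₂ _)   (inj₁ r~y) = no-three-arcs-into (ep ∷ er ∷ ey ∷ []) p≢r (≢-sym y≢p) (≢-sym y≢r) p~y r~y
      sides (inj₁ _)   (inj₂ q~y) (inj₂ r~y) = no-three-arcs-out  (eq ∷ er ∷ ey ∷ []) q≢r (≢-sym y≢q) (≢-sym y≢r) q~y r~y
      sides (inj₂ _)   (inj₁ q~y) (inj₁ r~y) = no-three-arcs-into (eq ∷ er ∷ ey ∷ []) q≢r (≢-sym y≢q) (≢-sym y≢r) q~y r~y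
      sides (inj₂ p~y) (inj₁ _)   (inj₂ r~y) = no-three-arcs-out  (ep ∷ er ∷ ey ∷ []) p≢r (≢-sym y≢p) (≢-sym y≢r) p~y r~y

module Trails {A : Set} (R : A → A → Set) (R-sym : Symmetric R) (P : A → Set)
              (at-most-two : AtMostTwoNeighbours P R) where

  record IsTrail (L : List A) : Set where
    field
      unique : Unique L
      linked : Linked R L
      all-P  : All P L

  open IsTrail

  private
    -- b cannot be adjacent to an interior element: its two neighbours are already in the list.
    linked-append-at-second : ∀ {b x y L} → Linked R (x ∷ y ∷ L) → Unique (x ∷ y ∷ L) →
      All P (x ∷ y ∷ L) → P b → b ∉ x ∷ y ∷ L → R b y → Linked R ((x ∷ y ∷ L) ++ [ b ])
    linked-append-at-second {L = []} (xRy ∷ _) _ _ _ _ bRy = xRy ∷ R-sym bRy ∷ [-]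
    linked-append-at-second {L = z ∷ _} (xRy ∷ yRz ∷ _)
      ((x≢y ∷ x≢z ∷ _) ∷ (y≢z ∷ _) ∷ _) (px ∷ py ∷ pz ∷ _) pb b∉ bRy =
      ⊥-elim (at-most-two (py ∷ px ∷ pb ∷ pz ∷ []) distinct xRy bRy (R-sym yRz))
      where
        distinct : Unique (_ ∷ _ ∷ _ ∷ _ ∷ [])
        distinct = (≢-sym x≢y ∷ ≢-sym (b∉ ∘ there ∘ here) ∷ y≢z ∷ [])
                 ∷ (≢-sym (b∉ ∘ here) ∷ x≢z ∷ [])
                 ∷ ((b∉ ∘ there ∘ there ∘ here) ∷ [])
                 ∷ [] ∷ []

  linked-extend : ∀ {b L} → Linked R L → Unique L → All P L → P b → b ∉ L → Any (R b) L →
    Linked R (b ∷ L) ⊎ Linked R (L ++ [ b ])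
  linked-extend lk _ _ _ _ (here bRx) = inj₁ (bRx ∷ lk)
  linked-extend [-] _ _ _ _ (there ())
  linked-extend (xRy ∷ lk) L!@(_ ∷ yL!) ps@(_ ∷ yps) pb b∉ (there adj)
    with linked-extend lk yL! yps pb (b∉ ∘ there) adj
  ... | inj₂ lk′ = inj₂ (xRy ∷ lk′)
  ... | inj₁ (bRy ∷ _) = inj₂ (linked-append-at-second (xRy ∷ lk) L! ps pb b∉ bRy)

  trail-extend : ∀ {b L} → IsTrail L → P b → b ∉ L → Any (R b) L →
    ∃ λ L′ → IsTrail L′ × L ⊆ L′ × length L′ ≡ suc (length L)
  trail-extend {b} {L} tL pb b∉L adj with linked-extend (linked tL) (unique tL) (all-P tL) pb b∉L adj
  ... | inj₁ lk = b ∷ L , record { unique = ¬Any⇒All¬ L b∉L ∷ unique tL ; linked = lk ; all-P = pb ∷ all-P tL }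
                      , there , refl
  ... | inj₂ lk = L ++ [ b ]
                , record { unique = Unique.++⁺ (unique tL) ([] ∷ []) λ { (b∈L , here refl) → b∉L b∈L }
                         ; linked = lk ; all-P = ∷ʳ⁺ (all-P tL) pb }
                , ∈-++⁺ˡ , trans (length-++ L) (+-comm (length L) 1)

  module Closure (_≟_ : DecidableEquality A) (R? : Decidable R) (P? : U.Decidable P)
                 (univ : List A) (∈univ : ∀ a → a ∈ univ) where
    open import Data.List.Membership.DecPropositional _≟_ using (_∈?_)

    Closed : List A → Set
    Closed L = ∀ {b c} → P b → c ∈ L → R b c → b ∈ L

    record Component (a : A) : Set where
      field
        trail    : List A
        is-trail : IsTrail trail
        member   : a ∈ trail
        closed   : Closed trail

    private
      -- k is fuel: trails are duplicate-free, so length univ bounds their length.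
      grow : ∀ {a} k L → IsTrail L → a ∈ L → length univ < length L + k → Component a
      grow zero L tL _ overfull =
        ⊥-elim (<⇒≱ (subst (length univ <_) (+-identityʳ (length L)) overfull)
                    (Unique⇒length≤ (unique tL) (λ {x} _ → ∈univ x)))
      grow (suc k) L tL a∈L bound with any? (λ b → P? b ×-dec (¬? (b ∈? L) ×-dec any? (R? b) L)) univ
      ... | yes extendable =
        let b , pb , b∉L , adj = satisfied extendable
            L′ , tL′ , L⊆L′ , longer = trail-extend tL pb b∉L adj
        in grow k L′ tL′ (L⊆L′ a∈L)
             (subst (length univ <_) (trans (+-suc (length L) k) (cong (_+ k) (sym longer))) bound)
      ... | no ¬extendable = record { trail = L ; is-trail = tL ; member = a∈L ; closed = closed }
        where
          closed : Closed L
          closed {b} pb c∈L bRc = decidable-stable (b ∈? L) λ b∉L →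
            ¬extendable (lose (∈univ b) (pb , b∉L , lose c∈L bRc))

    component : ∀ {a} → P a → Component a
    component pa = grow (length univ) [ _ ] singleton (here refl) ≤-refl
      where
        singleton : IsTrail [ _ ]
        singleton = record { unique = [] ∷ [] ; linked = [-] ; all-P = pa ∷ [] }

    private
      closed-absorbs-from-head : ∀ {L x xs} → Closed L → Linked R (x ∷ xs) → All P (x ∷ xs) →
        x ∈ L → All (_∈ L) (x ∷ xs)
      closed-absorbs-from-head cl [-] _ x∈L = x∈L ∷ []
      closed-absorbs-from-head cl (xRy ∷ lk) (_ ∷ ps) x∈L =
        x∈L ∷ closed-absorbs-from-head cl lk ps (cl (All.head ps) x∈L (R-sym xRy))

    closed-absorbs : ∀ {L xs} → Closed L → Linked R xs → All P xs → Any (_∈ L) xs → All (_∈ L) xs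
    closed-absorbs cl lk ps (here x∈L) = closed-absorbs-from-head cl lk ps x∈L
    closed-absorbs cl [-] _ (there ())
    closed-absorbs cl (xRy ∷ lk) (px ∷ ps) (there hit) with closed-absorbs cl lk ps hit
    ... | y∈L ∷ rest = cl px y∈L xRy ∷ y∈L ∷ rest

module _ {n : ℕ} where

  _≟ₐ_ : DecidableEquality (Arc n)
  _≟ₐ_ = ≡-dec _≟_ _≟_

  open import Data.List.Membership.DecPropositional _≟ₐ_ using (_∈?_)

  ZZStep-sym : Symmetric (ZZStep {n})
  ZZStep-sym (inj₁ same-head) = inj₁ (sym same-head)
  ZZStep-sym (inj₂ same-tail) = inj₂ (sym same-tail)

  ZZStep? : Decidable (ZZStep {n})
  ZZStep? a b = (head a ≟ head b) ⊎-dec (tail a ≟ tail b)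

  all-arcs : List (Arc n)
  all-arcs = cartesianProduct (allFin n) (allFin n)

  ∈-all-arcs : ∀ a → a ∈ all-arcs
  ∈-all-arcs (u , v) = ∈-cartesianProduct⁺ (∈-allFin u) (∈-allFin v)

  arcSet : List (Arc n) → ArcSet n
  arcSet L u v = ⌊ (u , v) ∈? L ⌋

  ∈⇔∈A-arcSet : ∀ {L} a → a ∈ L ⇔ a ∈A arcSet L
  ∈⇔∈A-arcSet a = mk⇔ fromWitness toWitness

  ⊆A-antisym : ∀ {A B : ArcSet n} → A ⊆A B → B ⊆A A → A ≐A B
  ⊆A-antisym {A} {B} A⊆B B⊆A u v with A u v in Auv | B u v in Buv
  ... | false | false = refl
  ... | true  | true  = refl
  ... | false | true  = ⊥-elim (subst T Auv (B⊆A (u , v) (subst T (sym Buv) _)))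
  ... | true  | false = ⊥-elim (subst T Buv (A⊆B (u , v) (subst T (sym Auv) _)))

  _++ᵘ_ : ∀ {A : ArcSet n} {x y z} → UWalk A x y → UWalk A y z → UWalk A x z
  stop    ++ᵘ w = w
  fwd t v ++ᵘ w = fwd t (v ++ᵘ w)
  bwd t v ++ᵘ w = bwd t (v ++ᵘ w)

  reverseᵘ : ∀ {A : ArcSet n} {x y} → UWalk A x y → UWalk A y x
  reverseᵘ stop      = stop
  reverseᵘ (fwd t w) = reverseᵘ w ++ᵘ bwd t stop
  reverseᵘ (bwd t w) = reverseᵘ w ++ᵘ fwd t stop

  module _ {A : ArcSet n} where
    private
      endpoint-walk : ∀ {c x} → c ∈A A → (tail c ≡ x ⊎ head c ≡ x) → UWalk A x (tail c)
      endpoint-walk _   (inj₁ refl) = stop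
      endpoint-walk c∈A (inj₂ refl) = bwd c∈A stop

      ZZStep-walk : ∀ {c d} → ZZStep c d → c ∈A A → d ∈A A → UWalk A (tail d) (tail c)
      ZZStep-walk {_ , _} {_ , _} (inj₁ refl) c∈A d∈A = fwd d∈A (bwd c∈A stop)
      ZZStep-walk {_ , _} {_ , _} (inj₂ refl) _   _   = stop

      linked-walk : ∀ {c L a x} → Linked ZZStep (c ∷ L) → All (_∈A A) (c ∷ L) → a ∈ c ∷ L →
        (tail a ≡ x ⊎ head a ≡ x) → UWalk A x (tail c)
      linked-walk _ (c∈A ∷ _) (here refl) ends = endpoint-walk c∈A ends
      linked-walk [-] _ (there ()) _
      linked-walk (c~d ∷ lk) (c∈A ∷ rest@(d∈A ∷ _)) (there a∈) ends =
        linked-walk lk rest a∈ ends ++ᵘ ZZStep-walk c~d c∈A d∈A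

    zigzag-ordering⇒connected : ∀ {as} → (∀ a → a ∈ as ⇔ a ∈A A) → Linked ZZStep as → Connected A
    zigzag-ordering⇒connected {[]} enum _ _ _ (a , a∈A , _) _ with () ← Equivalence.from (enum a) a∈A
    zigzag-ordering⇒connected {c ∷ as} enum lk x y (a , a∈A , a-ends) (b , b∈A , b-ends) =
      linked-walk lk in-A (from a a∈A) a-ends ++ᵘ reverseᵘ (linked-walk lk in-A (from b b∈A) b-ends)
      where
        from : ∀ a → a ∈A A → a ∈ c ∷ as
        from a = Equivalence.from (enum a)
        in-A : All (_∈A A) (c ∷ as)
        in-A = All.tabulate λ {a} a∈ → Equivalence.to (enum a) a∈

  ArcDisjoint : ArcSet n → ArcSet n → Set
  ArcDisjoint A B = ∀ a → ¬ (a ∈A A × a ∈A B)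

  maximal-⊆⇒≐ : ∀ {E : Digraph n} {A B} → IsMaximalZigZag E A → IsZigZag E B → A ⊆A B → A ≐A B
  maximal-⊆⇒≐ {A = A} (_ , maximal) zzB A⊆B = ⊆A-antisym A⊆B λ a a∈B →
    decidable-stable (T? (A (tail a) (head a))) λ a∉A →
      maximal (_ , zzB , A⊆B , λ A≐B → a∉A (subst T (sym (A≐B (tail a) (head a))) a∈B))

module ZigZagDecomposition {n} {E : Digraph n} (deg≤2 : DegreesAtMostTwo E) where
  open Trails ZZStep ZZStep-sym (_∈A E) (ZZStep-AtMostTwoNeighbours deg≤2)
  open Closure _≟ₐ_ ZZStep? (λ a → T? (E (tail a) (head a))) all-arcs ∈-all-arcs
  open Component
  open IsTrail

  private
    to : ∀ {L : List (Arc n)} a → a ∈ L → a ∈A arcSet L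
    to a = Equivalence.to (∈⇔∈A-arcSet a)

    from : ∀ {L : List (Arc n)} a → a ∈A arcSet L → a ∈ L
    from a = Equivalence.from (∈⇔∈A-arcSet a)

  component-set : ∀ {a} → Component a → ArcSet n
  component-set C = arcSet (trail C)

  component-isZigZag : ∀ {a} (C : Component a) → IsZigZag E (component-set C)
  component-isZigZag {a} C =
    (λ b b∈C → All.lookup (all-P (is-trail C)) (from b b∈C)) ,
    (a , to a (member C)) ,
    zigzag-ordering⇒connected ∈⇔∈A-arcSet (linked (is-trail C)) ,
    (trail C , unique (is-trail C) , ∈⇔∈A-arcSet , linked (is-trail C))

  zigzag⊆component : ∀ {a B} (C : Component a) → IsZigZag E B → a ∈A B → B ⊆A component-set C
  zigzag⊆component {a} C (B⊆E , _ , _ , bs , _ , enum , lk) a∈B b b∈B =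
    to b (All.lookup absorbed (Equivalence.from (enum b) b∈B))
    where
      absorbed : All (_∈ trail C) bs
      absorbed = closed-absorbs (closed C) lk
        (All.tabulate λ {x} x∈bs → B⊆E x (Equivalence.to (enum x) x∈bs))
        (lose (Equivalence.from (enum a) a∈B) (member C))

  component-isMaximal : ∀ {a} (C : Component a) → IsMaximalZigZag E (component-set C)
  component-isMaximal {a} C = component-isZigZag C , λ (B , zzB , C⊆B , C≭B) →
    C≭B (⊆A-antisym C⊆B (zigzag⊆component C zzB (C⊆B a (to a (member C)))))

  maximal≐component : ∀ {a A} (C : Component a) → IsMaximalZigZag E A → a ∈A A → A ≐A component-set C
  maximal≐component C mA a∈A =
    maximal-⊆⇒≐ mA (component-isZigZag C) (zigzag⊆component C (proj₁ mA) a∈A)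

  maximal-zigzags-sharing-arc-≐ : ∀ {a A B} → IsMaximalZigZag E A → IsMaximalZigZag E B →
    a ∈A A → a ∈A B → A ≐A B
  maximal-zigzags-sharing-arc-≐ {a} mA mB a∈A a∈B u v =
    trans (maximal≐component C mA a∈A u v) (sym (maximal≐component C mB a∈B u v))
    where
      C : Component a
      C = component (proj₁ (proj₁ mA) a a∈A)

  record PartialDecomposition (as : List (Arc n)) : Set where
    field
      family   : List (ArcSet n)
      maximal  : All (IsMaximalZigZag E) family
      disjoint : AllPairs ArcDisjoint family
      covers   : ∀ {a} → a ∈ as → a ∈A E → Any (a ∈A_) family

  open PartialDecomposition

  unchanged : ∀ {a as} (D : PartialDecomposition as) → (a ∈A E → Any (a ∈A_) (family D)) →
    PartialDecomposition (a ∷ as)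
  unchanged D covers-a = record
    { family = family D ; maximal = maximal D ; disjoint = disjoint D
    ; covers = λ { (here refl) → covers-a ; (there b∈as) → covers D b∈as } }

  partial-decomposition : ∀ as → PartialDecomposition as
  partial-decomposition [] = record { family = [] ; maximal = [] ; disjoint = [] ; covers = λ () }
  partial-decomposition (a ∷ as)
    with D ← partial-decomposition as
    with T? (E (tail a) (head a)) | any? (λ A → T? (A (tail a) (head a))) (family D)
  ... | no a∉E | _ = unchanged D λ a∈E → ⊥-elim (a∉E a∈E)
  ... | yes _ | yes covered = unchanged D λ _ → covered
  ... | yes a∈E | no uncovered = record
    { family   = component-set C ∷ family D
    ; maximal  = component-isMaximal C ∷ maximal D
    ; disjoint = fresh ∷ disjoint D
    ; covers   = λ { (here refl) _ → here (to a (member C)) ; (there b∈as) → there ∘ covers D b∈as }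
    }
    where
      C : Component a
      C = component a∈E

      fresh : All (ArcDisjoint (component-set C)) (family D)
      fresh = All.tabulate λ {B} B∈D b (b∈C , b∈B) →
        let C≐B = maximal-zigzags-sharing-arc-≐ (component-isMaximal C) (All.lookup (maximal D) B∈D) b∈C b∈B
        in uncovered (lose B∈D (subst T (C≐B (tail a) (head a)) (to a (member C))))

  maximal-zigzag-decomposition : Σ (List (ArcSet n)) λ D → IsDecomposition E D × All (IsMaximalZigZag E) D
  maximal-zigzag-decomposition =
    family D ,
    (All.map (proj₁ ∘ proj₁) (maximal D) , All.map (proj₁ ∘ proj₂ ∘ proj₁) (maximal D) ,
     disjoint D , λ a → covers D (∈-all-arcs a)) ,
    maximal D
    where
      D : PartialDecomposition all-arcs
      D = partial-decomposition all-arcs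

  maximal-family-⊆-covering : ∀ {D D′} → All (IsMaximalZigZag E) D → All (IsMaximalZigZag E) D′ →
    (∀ a → a ∈A E → Any (a ∈A_) D′) → All (λ A → Any (A ≐A_) D′) D
  maximal-family-⊆-covering {D′ = D′} maxD maxD′ covers′ = All.map matching maxD
    where
      matching : ∀ {A} → IsMaximalZigZag E A → Any (A ≐A_) D′
      matching mA@((A⊆E , (a , a∈A) , _) , _) with B , B∈D′ , a∈B ← find (covers′ a (A⊆E a a∈A)) =
        lose B∈D′ (maximal-zigzags-sharing-arc-≐ mA (All.lookup maxD′ B∈D′) a∈A a∈B)

  unique-maximal-zigzag-decomposition :
    Σ (List (ArcSet n)) λ D →
      (IsDecomposition E D × All (IsMaximalZigZag E) D) ×
      (∀ D′ → IsDecomposition E D′ → All (IsMaximalZigZag E) D′ → SameFamily D D′)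
  unique-maximal-zigzag-decomposition
    with D , decomposition@(_ , _ , _ , covers) , maximal ← maximal-zigzag-decomposition =
    D , (decomposition , maximal) ,
    λ D′ (_ , _ , _ , covers′) maximal′ →
      maximal-family-⊆-covering maximal maximal′ covers′ ,
      maximal-family-⊆-covering maximal′ maximal covers

theorem4p2 : ∀ {n} (X : Subset n) (E : Digraph n) → Nonempty X → IsRBPN X E →
    Σ (List (ArcSet n)) λ D →
      (IsDecomposition E D × All (IsMaximalZigZag E) D) ×
      (∀ D' → IsDecomposition E D' → All (IsMaximalZigZag E) D' → SameFamily D D')
theorem4p2 X E _ N = ZigZagDecomposition.unique-maximal-zigzag-decomposition (IsRBPN⇒DegreesAtMostTwo N)
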